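{- Let $a_n^{(2)}$ denote the number of $n$-step self-avoiding walks starting at $(0,0)$ and confined to the strip $\{0,1\} \times \mathbb{Z}$. Then $a_0^{(2)} = 1$, $a_1^{(2)} = 3$, and for all $n > 1$, $$a_n^{(2)} = 8 F_n - \frac{n}{2}\bigl(1 + (-1)^n\bigr) - 2\bigl(1 - (-1)^n\bigr),$$ where $F_n$ denotes the $n$-th Fibonacci number.
   Context: A self-avoiding walk with $n$ steps in the square lattice $\mathbb{Z}^2$ is a sequence of pairwise distinct lattice points $(x_0,y_0)=(0,0), (x_1,y_1), \dots, (x_n,y_n)$ such that for each $i$, $(x_{i+1},y_{i+1})$ is one of the four nearest neighbors $(x_i\pm 1, y_i)$, $(x_i, y_i \pm 1)$ of $(x_i,y_i)$. The walk is confined to the strip $\{0,1\}\times\mathbb{Z}$ if every $x_i \in \{0,1\}$. The Fibonacci numbers are given by $F_0=0$, $F_1=1$, $F_{n}=F_{n-1}+F_{n-2}$. -}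

module Defs where

open import Data.Nat as ℕ using (ℕ; zero; suc)
open import Data.Integer as ℤ using (ℤ; +_; _+_; _-_)
import Data.Integer.Properties as ℤP
open import Data.Product using (_×_; _,_; proj₁)
open import Data.Product.Properties using (≡-dec)
open import Data.List using (List; []; _∷_; map; concatMap; length; filter)
open import Data.List.Relation.Unary.All using (All; all?)
open import Data.List.Relation.Unary.AllPairs using (AllPairs; allPairs?)
open import Data.Sum using (_⊎_)
open import Relation.Nullary using (¬_; Dec; yes; no)
open import Relation.Nullary.Decidable using (_×-dec_; _⊎-dec_; ¬?)
open import Relation.Binary.PropositionalEquality using (_≡_; _≢_)

Point : Set
Point = ℤ × ℤ

data Step : Set where
  east west north south : Step

allSteps : List Step
allSteps = east ∷ west ∷ north ∷ south ∷ []

move : Step → Point → Point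
move east  (x , y) = (x + + 1 , y)
move west  (x , y) = (x - + 1 , y)
move north (x , y) = (x , y + + 1)
move south (x , y) = (x , y - + 1)

-- Nearest-neighbour walks of n steps, encoded by their step sequences
-- (this is a bijection: consecutive points are nearest neighbours).
stepSeqs : ℕ → List (List Step)
stepSeqs zero    = [] ∷ []
stepSeqs (suc n) = concatMap (λ s → map (s ∷_) (stepSeqs n)) allSteps

pointsFrom : Point → List Step → List Point
pointsFrom p []       = p ∷ []
pointsFrom p (s ∷ ss) = p ∷ pointsFrom (move s p) ss

origin : Point
origin = (+ 0 , + 0)

SelfAvoiding : List Step → Set
SelfAvoiding ss = AllPairs _≢_ (pointsFrom origin ss)

InStrip : Point → Set
InStrip (x , _) = (x ≡ + 0) ⊎ (x ≡ + 1)

Confined : List Step → Set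
Confined ss = All InStrip (pointsFrom origin ss)

_≟P_ : (p q : Point) → Dec (p ≡ q)
_≟P_ = ≡-dec ℤP._≟_ ℤP._≟_

inStrip? : (p : Point) → Dec (InStrip p)
inStrip? (x , _) = (x ℤP.≟ + 0) ⊎-dec (x ℤP.≟ + 1)

selfAvoidingStrip? : (ss : List Step) → Dec (SelfAvoiding ss × Confined ss)
selfAvoidingStrip? ss =
  allPairs? (λ p q → ¬? (p ≟P q)) (pointsFrom origin ss)
  ×-dec all? inStrip? (pointsFrom origin ss)

a2 : ℕ → ℕ
a2 n = length (filter selfAvoidingStrip? (stepSeqs n))

fib : ℕ → ℕ
fib zero          = 0
fib (suc zero)    = 1
fib (suc (suc n)) = fib (suc n) ℕ.+ fib n

negOnePow : ℕ → ℤ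
negOnePow zero    = + 1
negOnePow (suc n) = ℤ.- negOnePow n

-- Follow a walk one step at a time, remembering which points it may still enter; a2 n counts the
-- n-step continuations from the origin.  In the strip only a few shapes of the visited region matter
-- for the future: climbing a column while the other column is still free for m cells below, standing
-- on top of a dead-end corridor of length j, and, near the origin, rising in column 0 or having turned
-- into column 1 above it.  Each shape is an invariant on the set of free points, and the moves between
-- shapes give mutually recursive counts; walks that go below the origin reduce to walks going up by the
-- reflection y ↦ -y.  If σ(n) counts the continuations of a fresh climb and τ(n) those of a walk that
-- has just stepped up from the origin, then a(n+2) = 2σ(n) + 2τ(n+1), σ(n+2) = σ(n) + σ(n+1) + [n+1 even]
-- and τ(n+3) = σ(n+1) + 2σ(n) + τ(n+1) + 1, from which the Fibonacci closed forms follow by induction.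
module Submission where

open import Algebra.Bundles using (AbelianGroup)
open import Data.Bool using (Bool; true; false; _∧_; not; if_then_else_; T)
open import Data.Bool.Properties using (T-≡; ∧-zeroʳ)
open import Data.Empty using (⊥-elim)
open import Data.Integer as ℤ using (ℤ; +_; -[1+_])
import Data.Integer.Properties as ℤP
open import Data.List using (List; []; _∷_; _++_; map; concatMap; length; filter; filterᵇ)
open import Data.List.Properties using (filter-++; length-++; filter-≐; map-cong)
import Data.List.Relation.Unary.All as All
open import Data.List.Relation.Unary.All using (All; []; _∷_)
open import Data.List.Relation.Unary.AllPairs using (AllPairs; []; _∷_)
open import Data.Nat using (ℕ; zero; suc; _>_; _≤_; _<_; z≤n; s≤s)
open import Data.Nat.ListAction using (sum)
import Data.Nat.Properties as ℕP
open import Data.Product using (_×_; _,_; proj₁; proj₂; uncurry)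
open import Data.Sum using (_⊎_; inj₁; inj₂)
open import Function using (_∘_; Equivalence)
open import Relation.Nullary using (Dec; does; yes; no)
open import Relation.Nullary.Decidable using (dec-true; dec-false; T?)
open import Relation.Binary.PropositionalEquality

open import Algebra.Properties.Group (AbelianGroup.group ℤP.+-0-abelianGroup)
  using () renaming (∙-cancelˡ to +-cancelˡ)

open import Defs

module Counting where

  open import Data.Nat using (_+_)
  open import Data.Nat.Tactic.RingSolver using (solve-∀)
  open ≡-Reasoning

  Free : Set
  Free = Point → Bool

  _==_ : Point → Point → Bool
  p == q = does (p ≟P q)

  inStrip : Point → Bool
  inStrip p = does (inStrip? p)

  visit : Free → Point → Free
  visit free q r = free r ∧ not (r == q)

  enterable : Free → Point → Bool
  enterable free q = inStrip q ∧ free q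

  Enterable : Free → Point → Set
  Enterable free q = enterable free q ≡ true

  mutual
    walks : Free → Point → ℕ → ℕ
    walks free p zero    = 1
    walks free p (suc n) = sum (map (λ s → stepInto free (move s p) n) allSteps)

    stepInto : Free → Point → ℕ → ℕ
    stepInto free q n = if enterable free q then walks (visit free q) q n else 0

  ∧-≡-true⁻ : ∀ a b → a ∧ b ≡ true → a ≡ true × b ≡ true
  ∧-≡-true⁻ true b b≡true = refl , b≡true

  ∧-≡-true : ∀ {a b} → a ≡ true → b ≡ true → a ∧ b ≡ true
  ∧-≡-true refl b≡true = b≡true

  does-true⁻ : ∀ {A : Set} (a? : Dec A) → does a? ≡ true → A
  does-true⁻ (yes a) _ = a

  visited≢free : ∀ (free : Free) {p r : Point} → free p ≡ false → free r ≡ true → p ≢ r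
  visited≢free free p-visited r-free refl with trans (sym p-visited) r-free
  ... | ()

  visit-self : ∀ free q → visit free q q ≡ false
  visit-self free q rewrite dec-true (q ≟P q) refl = ∧-zeroʳ (free q)

  visit-free : ∀ free q r → free r ≡ true → r ≢ q → visit free q r ≡ true
  visit-free free q r r-free r≢q rewrite r-free | dec-false (r ≟P q) r≢q = refl

  visit-visited : ∀ free q r → free r ≡ false → visit free q r ≡ false
  visit-visited free q r r-visited rewrite r-visited = refl

  enterable-visit⁻ : ∀ free q r → Enterable (visit free q) r → Enterable free r
  enterable-visit⁻ free q r r-enterable with ∧-≡-true⁻ (inStrip r) _ r-enterable
  ... | r∈strip , r-free = ∧-≡-true r∈strip (proj₁ (∧-≡-true⁻ (free r) _ r-free))

  enterable-visit : ∀ free q r → Enterable free r → q ≢ r → Enterable (visit free q) r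
  enterable-visit free q r r-enterable q≢r with ∧-≡-true⁻ (inStrip r) _ r-enterable
  ... | r∈strip , r-free = ∧-≡-true r∈strip (visit-free free q r r-free (≢-sym q≢r))

  stepInto-visited : ∀ free q n → free q ≡ false → stepInto free q n ≡ 0
  stepInto-visited free q n q-visited rewrite q-visited | ∧-zeroʳ (inStrip q) = refl

  stepInto-free : ∀ free q n → inStrip q ≡ true → free q ≡ true →
    stepInto free q n ≡ walks (visit free q) q n
  stepInto-free free q n q∈strip q-free rewrite q∈strip | q-free = refl

  fits : Free → Point → List Step → Bool
  fits free p []       = true
  fits free p (s ∷ ss) = enterable free (move s p) ∧ fits (visit free (move s p)) (move s p) ss

  module _ {A : Set} (g : A → Bool) where

    length-filterᵇ-concatMap : ∀ {B : Set} (h : B → List A) bs →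
      length (filterᵇ g (concatMap h bs)) ≡ sum (map (λ b → length (filterᵇ g (h b))) bs)
    length-filterᵇ-concatMap h []       = refl
    length-filterᵇ-concatMap h (b ∷ bs) = begin
      length (filterᵇ g (h b ++ concatMap h bs))
        ≡⟨ cong length (filter-++ (T? ∘ g) (h b) (concatMap h bs)) ⟩
      length (filterᵇ g (h b) ++ filterᵇ g (concatMap h bs))
        ≡⟨ length-++ (filterᵇ g (h b)) ⟩
      length (filterᵇ g (h b)) + length (filterᵇ g (concatMap h bs))
        ≡⟨ cong (λ k → length (filterᵇ g (h b)) + k) (length-filterᵇ-concatMap h bs) ⟩
      sum (map (λ b → length (filterᵇ g (h b))) (b ∷ bs)) ∎

    length-filterᵇ-map : ∀ {B : Set} (h : B → A) xs →
      length (filterᵇ g (map h xs)) ≡ length (filterᵇ (g ∘ h) xs)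
    length-filterᵇ-map h []       = refl
    length-filterᵇ-map h (x ∷ xs) with g (h x)
    ... | true  = cong suc (length-filterᵇ-map h xs)
    ... | false = length-filterᵇ-map h xs

    length-filterᵇ-guard : ∀ b xs →
      length (filterᵇ (λ x → b ∧ g x) xs) ≡ (if b then length (filterᵇ g xs) else 0)
    length-filterᵇ-guard true  xs       = refl
    length-filterᵇ-guard false []       = refl
    length-filterᵇ-guard false (x ∷ xs) = length-filterᵇ-guard false xs

  count-fits : ∀ n free p → length (filterᵇ (fits free p) (stepSeqs n)) ≡ walks free p n
  count-fits zero    free p = refl
  count-fits (suc n) free p = begin
    length (filterᵇ (fits free p) (stepSeqs (suc n)))
      ≡⟨ length-filterᵇ-concatMap (fits free p) (λ s → map (s ∷_) (stepSeqs n)) allSteps ⟩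
    sum (map (λ s → length (filterᵇ (fits free p) (map (s ∷_) (stepSeqs n)))) allSteps)
      ≡⟨ cong sum (map-cong first-step allSteps) ⟩
    walks free p (suc n) ∎
    where
    first-step : ∀ s → length (filterᵇ (fits free p) (map (s ∷_) (stepSeqs n))) ≡ stepInto free (move s p) n
    first-step s = begin
      length (filterᵇ (fits free p) (map (s ∷_) (stepSeqs n)))
        ≡⟨ length-filterᵇ-map (fits free p) (s ∷_) (stepSeqs n) ⟩
      length (filterᵇ (λ ss → enterable free q ∧ fits (visit free q) q ss) (stepSeqs n))
        ≡⟨ length-filterᵇ-guard (fits (visit free q) q) (enterable free q) (stepSeqs n) ⟩
      (if enterable free q then length (filterᵇ (fits (visit free q) q) (stepSeqs n)) else 0)
        ≡⟨ cong (if enterable free q then_else 0) (count-fits n (visit free q) q) ⟩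
      stepInto free q n ∎
      where
      q : Point
      q = move s p

  pointsAfter : Point → List Step → List Point
  pointsAfter p []       = []
  pointsAfter p (s ∷ ss) = pointsFrom (move s p) ss

  pointsFrom-∷ : ∀ p ss → pointsFrom p ss ≡ p ∷ pointsAfter p ss
  pointsFrom-∷ p []      = refl
  pointsFrom-∷ p (_ ∷ _) = refl

  fits-sound : ∀ free p ss → free p ≡ false → fits free p ss ≡ true →
    AllPairs _≢_ (pointsFrom p ss) × All (Enterable free) (pointsAfter p ss)
  fits-sound free p []       _         _         = [] ∷ [] , []
  fits-sound free p (s ∷ ss) p-visited fits-s∷ss = All.map p≢ later ∷ proj₁ rest , later
    where
    q : Point
    q = move s p
    first : enterable free q ≡ true × fits (visit free q) q ss ≡ true
    first = ∧-≡-true⁻ (enterable free q) _ fits-s∷ss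
    rest : AllPairs _≢_ (pointsFrom q ss) × All (Enterable (visit free q)) (pointsAfter q ss)
    rest = fits-sound (visit free q) q ss (visit-self free q) (proj₂ first)
    later : All (Enterable free) (pointsFrom q ss)
    later = subst (All (Enterable free)) (sym (pointsFrom-∷ q ss))
      (proj₁ first ∷ All.map (enterable-visit⁻ free q _) (proj₂ rest))
    p≢ : ∀ {r} → Enterable free r → p ≢ r
    p≢ {r} r-enterable = visited≢free free p-visited (proj₂ (∧-≡-true⁻ (inStrip r) _ r-enterable))

  fits-complete : ∀ free p ss → AllPairs _≢_ (pointsFrom p ss) → All (Enterable free) (pointsAfter p ss) →
    fits free p ss ≡ true
  fits-complete free p []       _              _     = refl
  fits-complete free p (s ∷ ss) (_ ∷ distinct) later =
    first (subst (AllPairs _≢_) (pointsFrom-∷ q ss) distinct)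
          (subst (All (Enterable free)) (pointsFrom-∷ q ss) later)
    where
    q : Point
    q = move s p
    first : AllPairs _≢_ (q ∷ pointsAfter q ss) → All (Enterable free) (q ∷ pointsAfter q ss) →
      fits free p (s ∷ ss) ≡ true
    first (q-distinct ∷ _) (q-enterable ∷ later′) =
      ∧-≡-true q-enterable (fits-complete (visit free q) q ss distinct
        (All.zipWith (λ (r-enterable , q≢r) → enterable-visit free q _ r-enterable q≢r) (later′ , q-distinct)))

  startFree : Free
  startFree r = not (r == origin)

  startFree-≢ : ∀ r → origin ≢ r → startFree r ≡ true
  startFree-≢ r origin≢r = cong not (dec-false (r ≟P origin) (≢-sym origin≢r))

  stripSAW⇒fits : ∀ ss → SelfAvoiding ss × Confined ss → fits startFree origin ss ≡ true
  stripSAW⇒fits ss (distinct , confined) = fits-complete startFree origin ss distinct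
    (later (subst (AllPairs _≢_) (pointsFrom-∷ origin ss) distinct)
           (subst (All InStrip) (pointsFrom-∷ origin ss) confined))
    where
    enterable-start : ∀ r → InStrip r → origin ≢ r → Enterable startFree r
    enterable-start r r∈strip origin≢r =
      ∧-≡-true (dec-true (inStrip? r) r∈strip) (startFree-≢ r origin≢r)
    later : AllPairs _≢_ (origin ∷ pointsAfter origin ss) → All InStrip (origin ∷ pointsAfter origin ss) →
      All (Enterable startFree) (pointsAfter origin ss)
    later (origin-distinct ∷ _) (_ ∷ in-strip) =
      All.zipWith (uncurry (enterable-start _)) (in-strip , origin-distinct)

  fits⇒stripSAW : ∀ ss → fits startFree origin ss ≡ true → SelfAvoiding ss × Confined ss
  fits⇒stripSAW ss fits-ss = proj₁ sound , subst (All InStrip) (sym (pointsFrom-∷ origin ss))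
      (inj₁ refl ∷ All.map in-strip (proj₂ sound))
    where
    sound : AllPairs _≢_ (pointsFrom origin ss) × All (Enterable startFree) (pointsAfter origin ss)
    sound = fits-sound startFree origin ss refl fits-ss
    in-strip : ∀ {r} → Enterable startFree r → InStrip r
    in-strip {r} r-enterable = does-true⁻ (inStrip? r) (proj₁ (∧-≡-true⁻ (inStrip r) _ r-enterable))

  a2≡walks : ∀ n → a2 n ≡ walks startFree origin n
  a2≡walks n = begin
    length (filter selfAvoidingStrip? (stepSeqs n))
      ≡⟨ cong length (filter-≐ selfAvoidingStrip? (T? ∘ fits startFree origin) (to , from) (stepSeqs n)) ⟩
    length (filterᵇ (fits startFree origin) (stepSeqs n))
      ≡⟨ count-fits n startFree origin ⟩
    walks startFree origin n ∎
    where
    to : ∀ {ss} → SelfAvoiding ss × Confined ss → T (fits startFree origin ss)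
    to {ss} = Equivalence.from T-≡ ∘ stripSAW⇒fits ss
    from : ∀ {ss} → T (fits startFree origin ss) → SelfAvoiding ss × Confined ss
    from {ss} = fits⇒stripSAW ss ∘ Equivalence.to T-≡

  -- Reflection in the x-axis

  mutual
    walks-cong : ∀ n {free free′ : Free} → free ≗ free′ → ∀ p → walks free p n ≡ walks free′ p n
    walks-cong zero    eq p = refl
    walks-cong (suc n) eq p = cong sum (map-cong (λ s → stepInto-cong n eq (move s p)) allSteps)

    stepInto-cong : ∀ n {free free′ : Free} → free ≗ free′ → ∀ q →
      stepInto free q n ≡ stepInto free′ q n
    stepInto-cong n {free} {free′} eq q rewrite eq q =
      cong (if enterable free′ q then_else 0) (walks-cong n (λ r → cong (_∧ not (r == q)) (eq r)) q)

  reflect : Point → Point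
  reflect (x , y) = (x , ℤ.- y)

  reflect-involutive : ∀ r → reflect (reflect r) ≡ r
  reflect-involutive (x , y) = cong (x ,_) (ℤP.neg-involutive y)

  reflect-== : ∀ r q → (reflect r == q) ≡ (r == reflect q)
  reflect-== r q with reflect r ≟P q | r ≟P reflect q
  ... | yes _ | yes _ = refl
  ... | no  _ | no  _ = refl
  ... | yes e | no ne = ⊥-elim (ne (trans (sym (reflect-involutive r)) (cong reflect e)))
  ... | no ne | yes e = ⊥-elim (ne (trans (cong reflect e) (reflect-involutive q)))

  mutual
    walks-reflect : ∀ n free p → walks free p n ≡ walks (free ∘ reflect) (reflect p) n
    walks-reflect zero    free p       = refl
    walks-reflect (suc n) free (x , y) = begin
      into free (x ℤ.+ + 1 , y) + (into free (x ℤ.- + 1 , y) + (into free upper + (into free lower + 0)))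
        ≡⟨ cong₂ _+_ (stepInto-reflect n free (x ℤ.+ + 1 , y))
             (cong₂ _+_ (stepInto-reflect n free (x ℤ.- + 1 , y))
                        (cong₂ (λ a b → a + (b + 0)) upper↦lower′ lower↦upper′)) ⟩
      into free′ (x ℤ.+ + 1 , ℤ.- y)
        + (into free′ (x ℤ.- + 1 , ℤ.- y) + (into free′ lower′ + (into free′ upper′ + 0)))
        ≡⟨ cong (λ a → into free′ (x ℤ.+ + 1 , ℤ.- y) + (into free′ (x ℤ.- + 1 , ℤ.- y) + a))
             (swap (into free′ lower′) (into free′ upper′)) ⟩
      walks free′ (x , ℤ.- y) (suc n) ∎
      where
      into : Free → Point → ℕ
      into free q = stepInto free q n
      free′ : Free
      free′ = free ∘ reflect
      upper lower upper′ lower′ : Point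
      upper = (x , y ℤ.+ + 1)
      lower = (x , y ℤ.- + 1)
      upper′ = (x , ℤ.- y ℤ.+ + 1)
      lower′ = (x , ℤ.- y ℤ.- + 1)
      upper↦lower′ : into free upper ≡ into free′ lower′
      upper↦lower′ = trans (stepInto-reflect n free upper)
                           (cong (λ z → into free′ (x , z)) (ℤP.neg-distrib-+ y (+ 1)))
      lower↦upper′ : into free lower ≡ into free′ upper′
      lower↦upper′ = trans (stepInto-reflect n free lower)
                           (cong (λ z → into free′ (x , z)) (ℤP.neg-distrib-+ y -[1+ 0 ]))
      swap : ∀ a b → a + (b + 0) ≡ b + (a + 0)
      swap = solve-∀

    stepInto-reflect : ∀ n free q → stepInto free q n ≡ stepInto (free ∘ reflect) (reflect q) n
    stepInto-reflect n free (x , y) rewrite ℤP.neg-involutive y =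
      cong (if enterable free (x , y) then_else 0) (trans (walks-reflect n (visit free (x , y)) (x , y))
        (walks-cong n (λ r → cong (λ b → free (reflect r) ∧ not b) (reflect-== r (x , y))) (x , ℤ.- y)))

  above : ℤ → ℕ → ℤ
  above y k = y ℤ.+ + suc k

  below : ℤ → ℕ → ℤ
  below y i = y ℤ.+ -[1+ i ]

  above-above : ∀ y k → above (above y 0) k ≡ above y (suc k)
  above-above y k = ℤP.+-assoc y (+ 1) (+ suc k)

  below-above : ∀ y i → below (above y 0) (suc i) ≡ below y i
  below-above y i = ℤP.+-assoc y (+ 1) -[1+ suc i ]

  below-above-0 : ∀ y → below (above y 0) 0 ≡ y
  below-above-0 y = trans (ℤP.+-assoc y (+ 1) -[1+ 0 ]) (ℤP.+-identityʳ y)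

  below-below : ∀ y i → below (below y 0) i ≡ below y (suc i)
  below-below y i = ℤP.+-assoc y -[1+ 0 ] -[1+ i ]

  above-below-0 : ∀ y → above (below y 0) 0 ≡ y
  above-below-0 y = trans (ℤP.+-assoc y -[1+ 0 ] (+ 1)) (ℤP.+-identityʳ y)

  above-+ : ∀ k → above (+ k) 0 ≡ + suc k
  above-+ k = cong +_ (ℕP.+-comm k 1)

  rows-≢ : ∀ {x x′ : ℤ} y {a b} → a ≢ b → (x , y ℤ.+ a) ≢ (x′ , y ℤ.+ b)
  rows-≢ y a≢b eq = a≢b (+-cancelˡ y _ _ (cong proj₂ eq))

  row-≢ : ∀ {x x′ : ℤ} y {a} → a ≢ + 0 → (x , y ℤ.+ a) ≢ (x′ , y)
  row-≢ {x′ = x′} y a≢0 eq = rows-≢ y a≢0 (trans eq (cong (x′ ,_) (sym (ℤP.+-identityʳ y))))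

  rows⁺-≢ : ∀ {x x′ : ℤ} {r s} → r ≢ s → (x , + r) ≢ (x′ , + s)
  rows⁺-≢ r≢s refl = r≢s refl

  atRow : ∀ (free : Free) x {r r′ v} → r ≡ r′ → free (x , r′) ≡ v → free (x , r) ≡ v
  atRow free x refl eq = eq

  AboveFree : Free → ℤ → Set
  AboveFree free y = ∀ x k → free (x , above y k) ≡ true

  aboveFree-up : ∀ free y x → AboveFree free y → AboveFree (visit free (x , above y 0)) (above y 0)
  aboveFree-up free y x free↑ x′ k = atRow (visit free (x , above y 0)) x′ (above-above y k)
    (visit-free free _ _ (free↑ x′ (suc k)) (rows-≢ y λ ()))

  aboveFree-here : ∀ free y x → AboveFree free y → AboveFree (visit free (x , y)) y
  aboveFree-here free y x free↑ x′ k = visit-free free _ _ (free↑ x′ k) (row-≢ y λ ())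

  data Columns : ℤ → ℤ → Set where
    left  : Columns (+ 0) (+ 1)
    right : Columns (+ 1) (+ 0)

  Columns-swap : ∀ {c o} → Columns c o → Columns o c
  Columns-swap left  = right
  Columns-swap right = left

  Columns-inStrip : ∀ {c o} → Columns c o → ∀ y → inStrip (c , y) ≡ true
  Columns-inStrip left  y = refl
  Columns-inStrip right y = refl

  Columns-≢ : ∀ {c o} → Columns c o → ∀ {y y′ : ℤ} → (o , y) ≢ (c , y′)
  Columns-≢ left  ()
  Columns-≢ right ()

  +-reassoc : ∀ a b c → a + (b + (c + 0)) ≡ a + b + c
  +-reassoc = solve-∀

  walks-step : ∀ {c o} → Columns c o → ∀ free y n → walks free (c , y) (suc n) ≡
    stepInto free (o , y) n + stepInto free (c , above y 0) n + stepInto free (c , below y 0) n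
  walks-step left  free y n = +-reassoc (stepInto free (+ 1 , y) n) _ _
  walks-step right free y n = +-reassoc (stepInto free (+ 0 , y) n) _ _

  -- Walks away from the origin

  record DeadEnd (free : Free) (c o y : ℤ) (j : ℕ) : Set where
    field
      visited            : free (c , y) ≡ false
      besideVisited      : free (o , y) ≡ false
      belowFree          : ∀ i → i < j → free (c , below y i) ≡ true
      belowEnd           : free (c , below y j) ≡ false
      besideBelowVisited : ∀ i → i < j → free (o , below y i) ≡ false

  record Climbing (free : Free) (c o y : ℤ) (m : ℕ) : Set where
    field
      visited         : free (c , y) ≡ false
      aboveFree       : AboveFree free y
      besideFree      : free (o , y) ≡ true
      besideBelowFree : ∀ i → i < m → free (o , below y i) ≡ true
      besideBelowEnd  : free (o , below y m) ≡ false
      belowVisited    : ∀ i → i ≤ m → free (c , below y i) ≡ false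

  deadEnd-down : ∀ {free c o y j} → DeadEnd free c o y (suc j) →
    DeadEnd (visit free (c , below y 0)) c o (below y 0) j
  deadEnd-down {free} {c} {o} {y} {j} D = record
    { visited            = visit-self free here
    ; besideVisited      = visit-visited free here _ (besideBelowVisited 0 (s≤s z≤n))
    ; belowFree          = λ i i<j → atRow free′ c (below-below y i)
                             (visit-free free here _ (belowFree (suc i) (s≤s i<j)) (rows-≢ y λ ()))
    ; belowEnd           = atRow free′ c (below-below y j) (visit-visited free here _ belowEnd)
    ; besideBelowVisited = λ i i<j → atRow free′ o (below-below y i)
                             (visit-visited free here _ (besideBelowVisited (suc i) (s≤s i<j)))
    }
    where
    open DeadEnd D
    here : Point
    here = (c , below y 0)
    free′ : Free
    free′ = visit free here

  climbing-up : ∀ {free c o y m} → Columns c o → Climbing free c o y m →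
    Climbing (visit free (c , above y 0)) c o (above y 0) (suc m)
  climbing-up {free} {c} {o} {y} {m} cols S = record
    { visited         = visit-self free here
    ; aboveFree       = aboveFree-up free y c aboveFree
    ; besideFree      = visit-free free here _ (aboveFree o 0) (Columns-≢ cols)
    ; besideBelowFree = λ
        { zero    _         → atRow free′ o (below-above-0 y)
                                (visit-free free here _ besideFree (≢-sym (row-≢ y λ ())))
        ; (suc i) (s≤s i<m) → atRow free′ o (below-above y i)
                                (visit-free free here _ (besideBelowFree i i<m) (rows-≢ y λ ()))
        }
    ; besideBelowEnd  = atRow free′ o (below-above y m) (visit-visited free here _ besideBelowEnd)
    ; belowVisited    = λ
        { zero    _         → atRow free′ c (below-above-0 y) (visit-visited free here _ visited)
        ; (suc i) (s≤s i≤m) → atRow free′ c (below-above y i)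
                                (visit-visited free here _ (belowVisited i i≤m))
        }
    }
    where
    open Climbing S
    here : Point
    here = (c , above y 0)
    free′ : Free
    free′ = visit free here

  climbing-cross : ∀ {free c o y m} → Climbing free c o y m → DeadEnd (visit free (o , y)) o c y m
  climbing-cross {free} {c} {o} {y} {m} S = record
    { visited            = visit-self free (o , y)
    ; besideVisited      = visit-visited free _ _ visited
    ; belowFree          = λ i i<m → visit-free free _ _ (besideBelowFree i i<m) (row-≢ y λ ())
    ; belowEnd           = visit-visited free _ _ besideBelowEnd
    ; besideBelowVisited = λ i i<m → visit-visited free _ _ (belowVisited i (ℕP.<⇒≤ i<m))
    }
    where open Climbing S

  climbing-start : ∀ {free c o y} → Columns c o → free (c , y) ≡ false → free (o , y) ≡ false →
    AboveFree free y → Climbing (visit free (c , above y 0)) c o (above y 0) 0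
  climbing-start {free} {c} {o} {y} cols here-visited beside-visited free↑ = record
    { visited         = visit-self free here
    ; aboveFree       = aboveFree-up free y c free↑
    ; besideFree      = visit-free free here _ (free↑ o 0) (Columns-≢ cols)
    ; besideBelowFree = λ _ ()
    ; besideBelowEnd  = atRow free′ o (below-above-0 y) (visit-visited free here _ beside-visited)
    ; belowVisited    = λ { zero z≤n →
                          atRow free′ c (below-above-0 y) (visit-visited free here _ here-visited) }
    }
    where
    here : Point
    here = (c , above y 0)
    free′ : Free
    free′ = visit free here

  corridor : ℕ → ℕ → ℕ
  corridor j       zero    = 1
  corridor zero    (suc n) = 0
  corridor (suc j) (suc n) = corridor j n

  mutual
    climbing : ℕ → ℕ → ℕ
    climbing m zero    = 1
    climbing m (suc n) = crossed m n + climbing (suc m) n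

    crossed : ℕ → ℕ → ℕ
    crossed m zero    = 1
    crossed m (suc n) = climbing 0 n + corridor m (suc n)

  mutual
    corridor-walks : ∀ n {free c o y j} → Columns c o → DeadEnd free c o y j →
      free (c , above y 0) ≡ false → walks free (c , y) n ≡ corridor j n
    corridor-walks zero    cols D up-visited = refl
    corridor-walks (suc n) {free} {c} {o} {y} {j} cols D up-visited = begin
      walks free (c , y) (suc n)
        ≡⟨ walks-step cols free y n ⟩
      stepInto free (o , y) n + stepInto free (c , above y 0) n + stepInto free (c , below y 0) n
        ≡⟨ cong₂ (λ a b → a + b + stepInto free (c , below y 0) n)
             (stepInto-visited free _ n (DeadEnd.besideVisited D)) (stepInto-visited free _ n up-visited) ⟩
      stepInto free (c , below y 0) n
        ≡⟨ stepInto-corridor n cols D ⟩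
      corridor j (suc n) ∎

    stepInto-corridor : ∀ n {free c o y j} → Columns c o → DeadEnd free c o y j →
      stepInto free (c , below y 0) n ≡ corridor j (suc n)
    stepInto-corridor n {free} {j = zero} cols D = stepInto-visited free _ n (DeadEnd.belowEnd D)
    stepInto-corridor n {free} {c} {y = y} {j = suc j} cols D =
      trans (stepInto-free free _ n (Columns-inStrip cols (below y 0)) (DeadEnd.belowFree D 0 (s≤s z≤n)))
        (corridor-walks n cols (deadEnd-down D)
          (atRow (visit free (c , below y 0)) c (above-below-0 y) (visit-visited free _ _ (DeadEnd.visited D))))

  mutual
    climbing-walks : ∀ n {free c o y m} → Columns c o → Climbing free c o y m →
      walks free (c , y) n ≡ climbing m n
    climbing-walks zero    cols S = refl
    climbing-walks (suc n) {free} {c} {o} {y} {m} cols S = begin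
      walks free (c , y) (suc n)
        ≡⟨ walks-step cols free y n ⟩
      stepInto free (o , y) n + stepInto free (c , above y 0) n + stepInto free (c , below y 0) n
        ≡⟨ cong₂ _+_ (cong₂ _+_
             (trans (stepInto-free free _ n (Columns-inStrip (Columns-swap cols) y) besideFree)
                    (crossed-walks n (Columns-swap cols) (climbing-cross S) (aboveFree-here free y o aboveFree)))
             (trans (stepInto-free free _ n (Columns-inStrip cols (above y 0)) (aboveFree c 0))
                    (climbing-walks n cols (climbing-up cols S))))
           (stepInto-visited free _ n (belowVisited 0 z≤n)) ⟩
      crossed m n + climbing (suc m) n + 0
        ≡⟨ ℕP.+-identityʳ _ ⟩
      climbing m (suc n) ∎
      where open Climbing S

    crossed-walks : ∀ n {free c o y m} → Columns c o → DeadEnd free c o y m → AboveFree free y →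
      walks free (c , y) n ≡ crossed m n
    crossed-walks zero    cols D free↑ = refl
    crossed-walks (suc n) {free} {c} {o} {y} {m} cols D free↑ = begin
      walks free (c , y) (suc n)
        ≡⟨ walks-step cols free y n ⟩
      stepInto free (o , y) n + stepInto free (c , above y 0) n + stepInto free (c , below y 0) n
        ≡⟨ cong₂ _+_ (cong₂ _+_
             (stepInto-visited free _ n besideVisited)
             (stepInto-climbing-start n cols visited besideVisited free↑))
           (stepInto-corridor n cols D) ⟩
      crossed m (suc n) ∎
      where open DeadEnd D

    stepInto-climbing-start : ∀ n {free c o y} → Columns c o →
      free (c , y) ≡ false → free (o , y) ≡ false → AboveFree free y →
      stepInto free (c , above y 0) n ≡ climbing 0 n
    stepInto-climbing-start n {free} {c} {y = y} cols here-visited beside-visited free↑ =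
      trans (stepInto-free free _ n (Columns-inStrip cols (above y 0)) (free↑ c 0))
            (climbing-walks n cols (climbing-start cols here-visited beside-visited free↑))

  -- Walks near the origin

  record Turned (free : Free) (k : ℕ) : Set where
    field
      visited         : free (+ 1 , + k) ≡ false
      column₀Visited  : ∀ r → r ≤ k → free (+ 0 , + r) ≡ false
      column₁Free     : ∀ r → r < k → free (+ 1 , + r) ≡ true
      belowOriginFree : ∀ x i → free (x , -[1+ i ]) ≡ true

  record Rising (free : Free) (k : ℕ) : Set where
    field
      column₀Visited  : ∀ r → r ≤ k → free (+ 0 , + r) ≡ false
      aboveFree       : AboveFree free (+ k)
      column₁Free     : ∀ r → r ≤ k → free (+ 1 , + r) ≡ true
      belowOriginFree : ∀ x i → free (x , -[1+ i ]) ≡ true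

  turned-visit : ∀ {free k} → (∀ r → r ≤ k → free (+ 0 , + r) ≡ false) →
    (∀ r → r < k → free (+ 1 , + r) ≡ true) → (∀ x i → free (x , -[1+ i ]) ≡ true) →
    Turned (visit free (+ 1 , + k)) k
  turned-visit {free} {k} column₀-visited column₁-free below-free = record
    { visited         = visit-self free here
    ; column₀Visited  = λ r r≤k → visit-visited free here _ (column₀-visited r r≤k)
    ; column₁Free     = λ r r<k → visit-free free here _ (column₁-free r r<k) (rows⁺-≢ (ℕP.<⇒≢ r<k))
    ; belowOriginFree = λ x i → visit-free free here _ (below-free x i) λ ()
    }
    where
    here : Point
    here = (+ 1 , + k)

  turned-down : ∀ {free k} → Turned free (suc k) → Turned (visit free (+ 1 , + k)) k
  turned-down T = turned-visit (λ r r≤k → column₀Visited r (ℕP.m≤n⇒m≤1+n r≤k))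
    (λ r r<k → column₁Free r (ℕP.m<n⇒m<1+n r<k)) belowOriginFree
    where open Turned T

  rising-turn : ∀ {free k} → Rising free k → Turned (visit free (+ 1 , + k)) k
  rising-turn R = turned-visit column₀Visited (λ r r<k → column₁Free r (ℕP.<⇒≤ r<k)) belowOriginFree
    where open Rising R

  rising-up : ∀ {free k} → Rising free k → Rising (visit free (+ 0 , + suc k)) (suc k)
  rising-up {free} {k} R = record
    { column₀Visited  = λ r r≤1+k → column₀ r (ℕP.m≤n⇒m<n∨m≡n r≤1+k)
    ; aboveFree       = subst (λ y → AboveFree (visit free (+ 0 , y)) y) (above-+ k)
                          (aboveFree-up free (+ k) (+ 0) aboveFree)
    ; column₁Free     = λ r r≤1+k →
                          visit-free free here _ (column₁ r (ℕP.m≤n⇒m<n∨m≡n r≤1+k)) λ ()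
    ; belowOriginFree = λ x i → visit-free free here _ (belowOriginFree x i) λ ()
    }
    where
    open Rising R
    here : Point
    here = (+ 0 , + suc k)
    column₀ : ∀ r → r < suc k ⊎ r ≡ suc k → visit free here (+ 0 , + r) ≡ false
    column₀ r (inj₁ (s≤s r≤k)) = visit-visited free here _ (column₀Visited r r≤k)
    column₀ r (inj₂ refl)      = visit-self free here
    column₁ : ∀ r → r < suc k ⊎ r ≡ suc k → free (+ 1 , + r) ≡ true
    column₁ r (inj₁ (s≤s r≤k)) = column₁Free r r≤k
    column₁ r (inj₂ refl)      = atRow free (+ 1) (sym (above-+ k)) (aboveFree (+ 1) 0)

  returning : ℕ → ℕ → ℕ
  returning j       zero    = 1
  returning zero    (suc n) = climbing 0 n
  returning (suc j) (suc n) = returning j n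

  turned : ℕ → ℕ → ℕ
  turned k zero    = 1
  turned k (suc n) = climbing 0 n + returning k (suc n)

  rising : ℕ → ℕ → ℕ
  rising k zero    = 1
  rising k (suc n) = turned k n + rising (suc k) n

  stripWalks : ℕ → ℕ
  stripWalks zero    = 1
  stripWalks (suc n) = turned 0 n + rising 1 n + rising 1 n

  mutual
    returning-walks : ∀ n {free k} → Turned free k → free (+ 1 , above (+ k) 0) ≡ false →
      walks free (+ 1 , + k) n ≡ returning k n
    returning-walks zero    T up-visited = refl
    returning-walks (suc n) {free} {k} T up-visited = begin
      walks free (+ 1 , + k) (suc n)
        ≡⟨ walks-step right free (+ k) n ⟩
      stepInto free (+ 0 , + k) n + stepInto free (+ 1 , above (+ k) 0) n + stepInto free (+ 1 , below (+ k) 0) n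
        ≡⟨ cong₂ (λ a b → a + b + stepInto free (+ 1 , below (+ k) 0) n)
             (stepInto-visited free _ n (Turned.column₀Visited T k ℕP.≤-refl))
             (stepInto-visited free _ n up-visited) ⟩
      stepInto free (+ 1 , below (+ k) 0) n
        ≡⟨ stepInto-returning n T ⟩
      returning k (suc n) ∎

    stepInto-returning : ∀ n {free k} → Turned free k →
      stepInto free (+ 1 , below (+ k) 0) n ≡ returning k (suc n)
    stepInto-returning n {free} {zero} T = begin
      stepInto free (+ 1 , -[1+ 0 ]) n
        ≡⟨ stepInto-reflect n free _ ⟩
      stepInto (free ∘ reflect) (+ 1 , above (+ 0) 0) n
        ≡⟨ stepInto-climbing-start n {y = + 0} right visited (column₀Visited 0 z≤n) belowOriginFree ⟩
      climbing 0 n ∎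
      where open Turned T
    stepInto-returning n {free} {suc k} T =
      trans (stepInto-free free _ n refl (Turned.column₁Free T k ℕP.≤-refl))
        (returning-walks n (turned-down T)
          (atRow (visit free (+ 1 , + k)) (+ 1) (above-+ k) (visit-visited free (+ 1 , + k) _ (Turned.visited T))))

  turned-walks : ∀ n {free k} → Turned free k → AboveFree free (+ k) → walks free (+ 1 , + k) n ≡ turned k n
  turned-walks zero    T free↑ = refl
  turned-walks (suc n) {free} {k} T free↑ = begin
    walks free (+ 1 , + k) (suc n)
      ≡⟨ walks-step right free (+ k) n ⟩
    stepInto free (+ 0 , + k) n + stepInto free (+ 1 , above (+ k) 0) n + stepInto free (+ 1 , below (+ k) 0) n
      ≡⟨ cong₂ _+_ (cong₂ _+_
           (stepInto-visited free _ n (column₀Visited k ℕP.≤-refl))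
           (stepInto-climbing-start n right visited (column₀Visited k ℕP.≤-refl) free↑))
         (stepInto-returning n T) ⟩
    turned k (suc n) ∎
    where open Turned T

  rising-walks : ∀ n {free k} → Rising free (suc k) → walks free (+ 0 , + suc k) n ≡ rising (suc k) n
  rising-walks zero    R = refl
  rising-walks (suc n) {free} {k} R = begin
    walks free (+ 0 , + suc k) (suc n)
      ≡⟨ walks-step left free (+ suc k) n ⟩
    stepInto free (+ 1 , + suc k) n + stepInto free (+ 0 , above (+ suc k) 0) n + stepInto free (+ 0 , + k) n
      ≡⟨ cong₂ _+_ (cong₂ _+_ turn up) (stepInto-visited free _ n (column₀Visited k (ℕP.n≤1+n k))) ⟩
    turned (suc k) n + rising (suc (suc k)) n + 0
      ≡⟨ ℕP.+-identityʳ _ ⟩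
    rising (suc k) (suc n) ∎
    where
    open Rising R
    turn : stepInto free (+ 1 , + suc k) n ≡ turned (suc k) n
    turn = trans (stepInto-free free _ n refl (column₁Free (suc k) ℕP.≤-refl))
                 (turned-walks n (rising-turn R) (aboveFree-here free (+ suc k) (+ 1) aboveFree))
    up : stepInto free (+ 0 , above (+ suc k) 0) n ≡ rising (suc (suc k)) n
    up = begin
      stepInto free (+ 0 , above (+ suc k) 0) n
        ≡⟨ cong (λ y → stepInto free (+ 0 , y) n) (above-+ (suc k)) ⟩
      stepInto free (+ 0 , + suc (suc k)) n
        ≡⟨ stepInto-free free _ n refl (atRow free (+ 0) (sym (above-+ (suc k))) (aboveFree (+ 0) 0)) ⟩
      walks (visit free (+ 0 , + suc (suc k))) (+ 0 , + suc (suc k)) n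
        ≡⟨ rising-walks n (rising-up R) ⟩
      rising (suc (suc k)) n ∎

  visit-startFree : ∀ q r → origin ≢ r → r ≢ q → visit startFree q r ≡ true
  visit-startFree q r origin≢r r≢q = visit-free startFree q r (startFree-≢ r origin≢r) r≢q

  turned-origin : Turned (visit startFree (+ 1 , + 0)) 0
  turned-origin = record
    { visited         = visit-self startFree (+ 1 , + 0)
    ; column₀Visited  = λ { zero z≤n → refl }
    ; column₁Free     = λ _ ()
    ; belowOriginFree = λ x i → visit-startFree (+ 1 , + 0) (x , -[1+ i ]) (λ ()) (λ ())
    }

  rising-origin : Rising (visit startFree (+ 0 , + 1)) 1
  rising-origin = record
    { column₀Visited  = λ { zero          _         → refl
                          ; (suc zero)    _         → visit-self startFree (+ 0 , + 1)
                          ; (suc (suc _)) (s≤s ())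
                          }
    ; aboveFree       = λ x k → visit-startFree (+ 0 , + 1) (x , + suc (suc k)) (λ ()) (λ ())
    ; column₁Free     = λ r _ → visit-startFree (+ 0 , + 1) (+ 1 , + r) (λ ()) (λ ())
    ; belowOriginFree = λ x i → visit-startFree (+ 0 , + 1) (x , -[1+ i ]) (λ ()) (λ ())
    }

  startFree-reflect : ∀ r → startFree (reflect r) ≡ startFree r
  startFree-reflect r = cong not (reflect-== r origin)

  stripWalks-walks : ∀ n → walks startFree origin n ≡ stripWalks n
  stripWalks-walks zero    = refl
  stripWalks-walks (suc n) = begin
    stepInto startFree (+ 1 , + 0) n
      + (stepInto startFree (+ 0 , + 1) n + (stepInto startFree (+ 0 , -[1+ 0 ]) n + 0))
      ≡⟨ cong₂ _+_ eastward (cong₂ _+_ northward (cong (λ a → a + 0) southward)) ⟩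
    turned 0 n + (rising 1 n + (rising 1 n + 0))
      ≡⟨ +-reassoc (turned 0 n) (rising 1 n) (rising 1 n) ⟩
    stripWalks (suc n) ∎
    where
    eastward : stepInto startFree (+ 1 , + 0) n ≡ turned 0 n
    eastward = trans (stepInto-free startFree _ n refl refl)
      (turned-walks n turned-origin (λ x k → visit-startFree (+ 1 , + 0) (x , + suc k) (λ ()) (λ ())))
    northward : stepInto startFree (+ 0 , + 1) n ≡ rising 1 n
    northward = trans (stepInto-free startFree _ n refl refl) (rising-walks n rising-origin)
    southward : stepInto startFree (+ 0 , -[1+ 0 ]) n ≡ rising 1 n
    southward = begin
      stepInto startFree (+ 0 , -[1+ 0 ]) n
        ≡⟨ stepInto-reflect n startFree (+ 0 , -[1+ 0 ]) ⟩
      stepInto (startFree ∘ reflect) (+ 0 , + 1) n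
        ≡⟨ stepInto-cong n startFree-reflect (+ 0 , + 1) ⟩
      stepInto startFree (+ 0 , + 1) n
        ≡⟨ northward ⟩
      rising 1 n ∎

  -- Recurrences

  evenInd : ℕ → ℕ
  evenInd zero          = 1
  evenInd (suc zero)    = 0
  evenInd (suc (suc n)) = evenInd n

  -- climbing (suc m) n ∸ climbing m n: the walks that climb i rows, cross, and descend the whole
  -- corridor beside them, which is one cell longer for m + 1 than for m; they have length m + 2 + 2i.
  climbingGain : ℕ → ℕ → ℕ
  climbingGain zero    zero    = 0
  climbingGain zero    (suc n) = evenInd (suc n)
  climbingGain (suc m) zero    = 0
  climbingGain (suc m) (suc n) = climbingGain m n

  climbingGain-0 : ∀ m → climbingGain m 0 ≡ 0
  climbingGain-0 zero    = refl
  climbingGain-0 (suc m) = refl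

  climbingGain-1 : ∀ m → climbingGain m 1 ≡ 0
  climbingGain-1 zero    = refl
  climbingGain-1 (suc m) = climbingGain-0 m

  corridor-gain : ∀ m n → corridor m n + climbingGain m n ≡ corridor m (suc n) + climbingGain m (suc (suc n))
  corridor-gain zero    zero    = refl
  corridor-gain zero    (suc n) = refl
  corridor-gain (suc m) zero    = cong suc (sym (climbingGain-1 m))
  corridor-gain (suc m) (suc n) = corridor-gain m n

  crossed-gain : ∀ m n → crossed (suc m) n + climbingGain (suc m) n ≡ crossed m n + climbingGain m (suc n)
  crossed-gain m zero    = cong suc (sym (climbingGain-1 m))
  crossed-gain m (suc n) = begin
    climbing 0 n + corridor m n + climbingGain m n
      ≡⟨ ℕP.+-assoc (climbing 0 n) _ _ ⟩
    climbing 0 n + (corridor m n + climbingGain m n)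
      ≡⟨ cong (λ x → climbing 0 n + x) (corridor-gain m n) ⟩
    climbing 0 n + (corridor m (suc n) + climbingGain m (suc (suc n)))
      ≡⟨ ℕP.+-assoc (climbing 0 n) _ _ ⟨
    climbing 0 n + corridor m (suc n) + climbingGain m (suc (suc n)) ∎

  climbing-gain : ∀ m n → climbing (suc m) n ≡ climbing m n + climbingGain m n
  climbing-gain m zero    = cong suc (sym (climbingGain-0 m))
  climbing-gain m (suc n) = begin
    crossed (suc m) n + climbing (suc (suc m)) n
      ≡⟨ cong (λ x → crossed (suc m) n + x) (climbing-gain (suc m) n) ⟩
    crossed (suc m) n + (climbing (suc m) n + climbingGain (suc m) n)
      ≡⟨ swap (crossed (suc m) n) (climbing (suc m) n) (climbingGain (suc m) n) ⟩
    crossed (suc m) n + climbingGain (suc m) n + climbing (suc m) n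
      ≡⟨ cong (λ x → x + climbing (suc m) n) (crossed-gain m n) ⟩
    crossed m n + climbingGain m (suc n) + climbing (suc m) n
      ≡⟨ swap′ (crossed m n) (climbingGain m (suc n)) (climbing (suc m) n) ⟩
    crossed m n + climbing (suc m) n + climbingGain m (suc n) ∎
    where
    swap : ∀ a b c → a + (b + c) ≡ a + c + b
    swap = solve-∀
    swap′ : ∀ a b c → a + b + c ≡ a + c + b
    swap′ = solve-∀

  climbing-rec : ∀ n → climbing 0 (suc (suc n)) ≡ climbing 0 n + climbing 0 (suc n) + evenInd (suc n)
  climbing-rec n = begin
    climbing 0 n + 0 + climbing 1 (suc n)
      ≡⟨ cong₂ _+_ (ℕP.+-identityʳ (climbing 0 n)) (climbing-gain 0 (suc n)) ⟩
    climbing 0 n + (climbing 0 (suc n) + evenInd (suc n))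
      ≡⟨ ℕP.+-assoc (climbing 0 n) _ _ ⟨
    climbing 0 n + climbing 0 (suc n) + evenInd (suc n) ∎

  turned-shift : ∀ k n → turned (suc k) (suc (suc n)) + climbing 0 n ≡ turned k (suc n) + climbing 0 (suc n)
  turned-shift k n = swap (climbing 0 (suc n)) (returning k (suc n)) (climbing 0 n)
    where
    swap : ∀ a b c → a + b + c ≡ c + b + a
    swap = solve-∀

  rising-shift : ∀ k n → rising (suc k) (suc (suc n)) ≡ rising k (suc n) + 1 + climbing 0 n
  rising-shift k zero    = refl
  rising-shift k (suc n) = begin
    turned (suc k) (suc (suc n)) + rising (suc (suc k)) (suc (suc n))
      ≡⟨ cong (λ x → turned (suc k) (suc (suc n)) + x) (rising-shift (suc k) n) ⟩
    turned (suc k) (suc (suc n)) + (rising (suc k) (suc n) + 1 + climbing 0 n)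
      ≡⟨ swap (turned (suc k) (suc (suc n))) (rising (suc k) (suc n)) (climbing 0 n) ⟩
    turned (suc k) (suc (suc n)) + climbing 0 n + (rising (suc k) (suc n) + 1)
      ≡⟨ cong (λ x → x + (rising (suc k) (suc n) + 1)) (turned-shift k n) ⟩
    turned k (suc n) + climbing 0 (suc n) + (rising (suc k) (suc n) + 1)
      ≡⟨ swap′ (turned k (suc n)) (climbing 0 (suc n)) (rising (suc k) (suc n)) ⟩
    turned k (suc n) + rising (suc k) (suc n) + 1 + climbing 0 (suc n) ∎
    where
    swap : ∀ a b c → a + (b + 1 + c) ≡ a + c + (b + 1)
    swap = solve-∀
    swap′ : ∀ a b c → a + b + (c + 1) ≡ a + c + 1 + b
    swap′ = solve-∀

  rising-rec : ∀ n → rising 1 (suc (suc (suc n))) ≡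
    climbing 0 (suc n) + climbing 0 n + (rising 1 (suc n) + 1 + climbing 0 n)
  rising-rec n = cong (λ x → climbing 0 (suc n) + climbing 0 n + x) (rising-shift 1 n)

open Counting using (climbing; rising; evenInd; climbing-rec; rising-rec; a2≡walks; stripWalks-walks)

-- Closed forms

open import Data.Integer using (_+_; _-_; _*_; -_)
open import Data.Integer.Tactic.RingSolver using (solve-∀)
open ≡-Reasoning

evenInd-negOnePow : ∀ n → + 2 * + evenInd n ≡ + 1 + negOnePow n
evenInd-negOnePow zero          = refl
evenInd-negOnePow (suc zero)    = refl
evenInd-negOnePow (suc (suc n)) =
  trans (evenInd-negOnePow n) (cong (λ x → + 1 + x) (sym (ℤP.neg-involutive (negOnePow n))))

-- Stated for 2σ and 4τ so that the halves (1 ± (-1)^n)/2 never occur.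
climbing-closed : ∀ n → + 2 * + climbing 0 n ≡ + 4 * + fib (suc n) - (+ 1 + negOnePow n)
climbing-closed zero          = refl
climbing-closed (suc zero)    = refl
climbing-closed (suc (suc n)) = begin
  + 2 * + climbing 0 (suc (suc n))
    ≡⟨ cong (λ x → + 2 * + x) (climbing-rec n) ⟩
  + 2 * (+ climbing 0 n + + climbing 0 (suc n) + + evenInd (suc n))
    ≡⟨ distrib (+ climbing 0 n) (+ climbing 0 (suc n)) (+ evenInd (suc n)) ⟩
  + 2 * + climbing 0 n + + 2 * + climbing 0 (suc n) + + 2 * + evenInd (suc n)
    ≡⟨ cong₂ _+_ (cong₂ _+_ (climbing-closed n) (climbing-closed (suc n))) (evenInd-negOnePow (suc n)) ⟩
  + 4 * + fib (suc n) - (+ 1 + s) + (+ 4 * + fib (suc (suc n)) - (+ 1 - s)) + (+ 1 - s)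
    ≡⟨ fibonacci (+ fib n) (+ fib (suc n)) s ⟩
  + 4 * + fib (suc (suc (suc n))) - (+ 1 + - - s) ∎
  where
  s : ℤ
  s = negOnePow n
  distrib : ∀ a b c → + 2 * (a + b + c) ≡ + 2 * a + + 2 * b + + 2 * c
  distrib = solve-∀
  fibonacci : ∀ f₀ f₁ s → + 4 * f₁ - (+ 1 + s) + (+ 4 * (f₁ + f₀) - (+ 1 - s)) + (+ 1 - s)
                         ≡ + 4 * ((f₁ + f₀) + f₁) - (+ 1 + - - s)
  fibonacci = solve-∀

rising-closed : ∀ n → + 4 * + rising 1 (suc n) ≡
  + 16 * + fib (suc (suc n)) - + 8 * + fib (suc n) - + n * (+ 1 + negOnePow n) - + 4 * (+ 1 - negOnePow n)
rising-closed zero          = refl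
rising-closed (suc zero)    = refl
rising-closed (suc (suc n)) = begin
  + 4 * + rising 1 (suc (suc (suc n)))
    ≡⟨ cong (λ x → + 4 * + x) (rising-rec n) ⟩
  + 4 * (+ climbing 0 (suc n) + + climbing 0 n + (+ rising 1 (suc n) + + 1 + + climbing 0 n))
    ≡⟨ regroup (+ climbing 0 (suc n)) (+ climbing 0 n) (+ rising 1 (suc n)) ⟩
  + 2 * (+ 2 * + climbing 0 (suc n)) + + 4 * (+ 2 * + climbing 0 n) + + 4 * + rising 1 (suc n) + + 4
    ≡⟨ cong₂ (λ ab t → ab + t + + 4)
         (cong₂ (λ a b → + 2 * a + + 4 * b) (climbing-closed (suc n)) (climbing-closed n)) (rising-closed n) ⟩
  + 2 * (+ 4 * + fib (suc (suc n)) - (+ 1 - s)) + + 4 * (+ 4 * + fib (suc n) - (+ 1 + s))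
    + (+ 16 * + fib (suc (suc n)) - + 8 * + fib (suc n) - + n * (+ 1 + s) - + 4 * (+ 1 - s)) + + 4
    ≡⟨ fibonacci (+ fib n) (+ fib (suc n)) (+ n) s ⟩
  + 16 * + fib (suc (suc (suc (suc n)))) - + 8 * + fib (suc (suc (suc n)))
    - + suc (suc n) * (+ 1 + - - s) - + 4 * (+ 1 - - - s) ∎
  where
  s : ℤ
  s = negOnePow n
  regroup : ∀ a b t → + 4 * (a + b + (t + + 1 + b)) ≡ + 2 * (+ 2 * a) + + 4 * (+ 2 * b) + + 4 * t + + 4
  regroup = solve-∀
  fibonacci : ∀ f₀ f₁ m s →
    + 2 * (+ 4 * (f₁ + f₀) - (+ 1 - s)) + + 4 * (+ 4 * f₁ - (+ 1 + s))
      + (+ 16 * (f₁ + f₀) - + 8 * f₁ - m * (+ 1 + s) - + 4 * (+ 1 - s)) + + 4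
    ≡ + 16 * (((f₁ + f₀) + f₁) + (f₁ + f₀)) - + 8 * ((f₁ + f₀) + f₁) - (+ 2 + m) * (+ 1 + - - s)
      - + 4 * (+ 1 - - - s)
  fibonacci = solve-∀

a2-closed : ∀ n → + a2 (suc (suc n)) * + 2 ≡
  + 16 * + fib (suc (suc n)) - + suc (suc n) * (+ 1 + negOnePow (suc (suc n)))
    - + 4 * (+ 1 - negOnePow (suc (suc n)))
a2-closed n = begin
  + a2 (suc (suc n)) * + 2
    ≡⟨ cong (λ x → + x * + 2) (trans (a2≡walks (suc (suc n))) (stripWalks-walks (suc (suc n)))) ⟩
  (+ climbing 0 n + + climbing 0 n + + rising 1 (suc n) + + rising 1 (suc n)) * + 2
    ≡⟨ regroup (+ climbing 0 n) (+ rising 1 (suc n)) ⟩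
  + 2 * (+ 2 * + climbing 0 n) + + 4 * + rising 1 (suc n)
    ≡⟨ cong₂ (λ a b → + 2 * a + b) (climbing-closed n) (rising-closed n) ⟩
  + 2 * (+ 4 * + fib (suc n) - (+ 1 + s))
    + (+ 16 * + fib (suc (suc n)) - + 8 * + fib (suc n) - + n * (+ 1 + s) - + 4 * (+ 1 - s))
    ≡⟨ collect (+ fib (suc n)) (+ fib (suc (suc n))) (+ n) s ⟩
  + 16 * + fib (suc (suc n)) - + suc (suc n) * (+ 1 + - - s) - + 4 * (+ 1 - - - s) ∎
  where
  s : ℤ
  s = negOnePow n
  regroup : ∀ a t → (a + a + t + t) * + 2 ≡ + 2 * (+ 2 * a) + + 4 * t
  regroup = solve-∀
  collect : ∀ f₁ f₂ m s →
    + 2 * (+ 4 * f₁ - (+ 1 + s)) + (+ 16 * f₂ - + 8 * f₁ - m * (+ 1 + s) - + 4 * (+ 1 - s))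
      ≡ + 16 * f₂ - (+ 2 + m) * (+ 1 + - - s) - + 4 * (+ 1 - - - s)
  collect = solve-∀

mainTheorem1 : (a2 0 ≡ 1) × (a2 1 ≡ 3) ×
    ((n : ℕ) → n > 1 →
      + a2 n * + 2 ≡ + 16 * + fib n - + n * (+ 1 + negOnePow n) - + 4 * (+ 1 - negOnePow n))
mainTheorem1 = refl , refl , λ where
  (suc zero)    (s≤s ())
  (suc (suc n)) _ → a2-closed n
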